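{- For every integer $q\ge 2$, the graph $\overline{ME_q}$ has a frozen $(2q+1)$-clique-partition.
   Context: For $q\ge 2$, $\overline{ME_q}$ is the graph with the $4q+2$ vertices $u_0,u_1,\dots,u_{q+1}$ and $v_{i1},v_{i2},v_{i3}$ ($i=1,\dots,q$), whose edges are: the edges of the Hamiltonian cycle $u_0,u_1,\dots,u_{q+1},v_{11},v_{12},v_{13},v_{21},v_{22},v_{23},\dots,v_{q1},v_{q2},v_{q3},u_0$; the edges $u_iv_{i2}$ for $i=1,\dots,q$; and the edges $v_{i1}v_{i3}$ for $i=1,\dots,q$. A $k$-clique-partition is a partition of the vertex set into at most $k$ (ordered, possibly empty) cliques; it is frozen if every vertex $v$ has a non-neighbour in each of the $k$ cliques other than the one containing $v$. -}

module Defs where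

open import Data.Nat using (ℕ; zero; suc; _+_)
open import Data.Fin using (Fin; zero; suc; inject₁; fromℕ)
open import Data.Product using (Σ; _×_; ∃)
open import Data.Sum using (_⊎_)
open import Relation.Binary.PropositionalEquality using (_≡_)
open import Relation.Nullary using (¬_)

IsCliquePartition : {V : Set} → (V → V → Set) → (k : ℕ) → (V → Fin k) → Set
IsCliquePartition {V} Adj k c = (x y : V) → c x ≡ c y → ¬ (x ≡ y) → Adj x y

IsFrozen : {V : Set} → (V → V → Set) → (k : ℕ) → (V → Fin k) → Set
IsFrozen {V} Adj k c =
  (x : V) (j : Fin k) → ¬ (j ≡ c x) → Σ V (λ y → (c y ≡ j) × ¬ Adj x y)

-- The graph co-ME_q.
-- Vertices: u i for i = 0 … q+1 (Fin (q+2)),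
--           v i a for i = 1 … q (Fin q, 0-based) and a = 1,2,3 (Fin 3, 0-based).

data MEVert (q : ℕ) : Set where
  u : Fin (suc (suc q)) → MEVert q
  v : Fin q → Fin 3 → MEVert q

v1 v2 v3 : Fin 3
v1 = zero
v2 = suc zero
v3 = suc (suc zero)

data MEEdge : (q : ℕ) → MEVert q → MEVert q → Set where
  -- Hamiltonian cycle: u_0 u_1 … u_{q+1}
  e-uu    : ∀ {q} (i : Fin (suc q)) → MEEdge q (u (inject₁ i)) (u (suc i))
  e-uv    : ∀ {p} → MEEdge (suc p) (u (fromℕ (suc (suc p)))) (v zero v1)
  e-v12   : ∀ {q} (i : Fin q) → MEEdge q (v i v1) (v i v2)
  e-v23   : ∀ {q} (i : Fin q) → MEEdge q (v i v2) (v i v3)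
  e-vnext : ∀ {p} (i : Fin p) → MEEdge (suc p) (v (inject₁ i) v3) (v (suc i) v1)
  e-vu    : ∀ {p} → MEEdge (suc p) (v (fromℕ p) v3) (u zero)
  -- chords u_i v_{i2}, i = 1 … q
  e-spoke : ∀ {q} (i : Fin q) → MEEdge q (u (suc (inject₁ i))) (v i v2)
  e-v13   : ∀ {q} (i : Fin q) → MEEdge q (v i v1) (v i v3)

MEAdj : (q : ℕ) → MEVert q → MEVert q → Set
MEAdj q x y = MEEdge q x y ⊎ MEEdge q y x

module Submission where

-- The 2q+1 edges u_i v_{i2} (1 ≤ i ≤ q), u_{q+1} v_{11}, v_{i3} v_{i+1,1} (1 ≤ i < q) and
-- v_{q3} u_0 form a perfect matching, so they partition the vertices into cliques.
-- None of them lies in a triangle (the only triangles are v_{i1} v_{i2} v_{i3}), so every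
-- vertex misses one of the two ends of each class, which makes the partition frozen.

open import Defs
open import Data.Nat using (ℕ; suc; _≤_; _+_; _*_; _≟_)
open import Data.Fin using (Fin; suc; toℕ; fromℕ; inject₁)
open import Data.Fin.Patterns using (0F; 1F; 2F)
open import Data.Fin.Properties using (toℕ-inject₁; toℕ-fromℕ; +↔⊎; *↔×; 1↔⊤)
open import Data.Fin.Relation.Unary.Top using (View; view; ‵fromℕ; ‵inject₁; view-fromℕ; view-inject₁)
open import Data.Product using (Σ; _×_; _,_)
open import Data.Sum as Sum using (_⊎_; inj₁; inj₂; swap; [_,_])
open import Data.Sum.Function.Propositional using (_⊎-cong_)
open import Data.Unit using (⊤; tt)
open import Function using (_∘_)
open import Function.Bundles using (_↔_; Inverse)
open import Function.Properties.Inverse using (↔-sym; ↔-trans)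
open import Relation.Binary using (Symmetric; Decidable)
open import Relation.Binary.PropositionalEquality using (_≡_; refl; sym; trans; cong; subst)
open import Relation.Nullary using (¬_; yes; no; contradiction)
open import Relation.Nullary.Decidable using (_⊎-dec_; _×-dec_; map′)

record TriangleFreeMatching {V C : Set} (Adj : V → V → Set) (class : V → C) : Set where
  field
    end₁ end₂           : C → V
    class-end₁          : ∀ j → class (end₁ j) ≡ j
    class-end₂          : ∀ j → class (end₂ j) ≡ j
    is-end              : ∀ x → x ≡ end₁ (class x) ⊎ x ≡ end₂ (class x)
    ends-adjacent       : ∀ j → Adj (end₁ j) (end₂ j)
    no-common-neighbour : ∀ j x → ¬ Adj x (end₁ j) ⊎ ¬ Adj x (end₂ j)

module _ {V : Set} {Adj : V → V → Set} where

  reindex : ∀ {C D : Set} {class : V → C} (φ : C ↔ D) →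
            TriangleFreeMatching Adj class → TriangleFreeMatching Adj (Inverse.to φ ∘ class)
  reindex {class = class} φ M = record
    { end₁                = end₁ ∘ from
    ; end₂                = end₂ ∘ from
    ; class-end₁          = λ j → trans (cong to (class-end₁ (from j))) (strictlyInverseˡ j)
    ; class-end₂          = λ j → trans (cong to (class-end₂ (from j))) (strictlyInverseˡ j)
    ; is-end              = λ x → subst (λ j → x ≡ end₁ j ⊎ x ≡ end₂ j)
                                        (sym (strictlyInverseʳ (class x))) (is-end x)
    ; ends-adjacent       = ends-adjacent ∘ from
    ; no-common-neighbour = no-common-neighbour ∘ from
    }
    where
    open TriangleFreeMatching M
    open Inverse φ

  module _ {k : ℕ} {c : V → Fin k} (M : TriangleFreeMatching Adj c) where
    open TriangleFreeMatching M

    isCliquePartition : Symmetric Adj → IsCliquePartition Adj k c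
    isCliquePartition sym-Adj x y cx≡cy =
      adjacent (is-end x) (subst (λ j → y ≡ end₁ j ⊎ y ≡ end₂ j) (sym cx≡cy) (is-end y))
      where
      adjacent : ∀ {j x y} → x ≡ end₁ j ⊎ x ≡ end₂ j → y ≡ end₁ j ⊎ y ≡ end₂ j → ¬ x ≡ y → Adj x y
      adjacent (inj₁ refl) (inj₁ refl) x≢y = contradiction refl x≢y
      adjacent (inj₁ refl) (inj₂ refl) _   = ends-adjacent _
      adjacent (inj₂ refl) (inj₁ refl) _   = sym-Adj (ends-adjacent _)
      adjacent (inj₂ refl) (inj₂ refl) x≢y = contradiction refl x≢y

    isFrozen : IsFrozen Adj k c
    isFrozen x j _ with no-common-neighbour j x
    ... | inj₁ x≁end₁ = end₁ j , class-end₁ j , x≁end₁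
    ... | inj₂ x≁end₂ = end₂ j , class-end₂ j , x≁end₂

pullback-no-common-neighbour :
  ∀ {V W : Set} {Adj : V → V → Set} {Adj′ : W → W → Set} (f : V → W) →
  (∀ {x y} → Adj x y → Adj′ (f x) (f y)) → Decidable Adj′ →
  ∀ {a b} → (∀ {z} → Adj′ z (f a) → ¬ Adj′ z (f b)) → ∀ x → ¬ Adj x a ⊎ ¬ Adj x b
pullback-no-common-neighbour f hom _≟ₐ_ {a} no-common x with f x ≟ₐ f a
... | yes fx∼fa = inj₂ (no-common fx∼fa ∘ hom)
... | no  fx≁fa = inj₁ (fx≁fa ∘ hom)

Class : ℕ → Set
Class q = Fin 2 × Fin q ⊎ ⊤

pattern spoke i = inj₁ (0F , i)
pattern link i  = inj₁ (1F , i)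
pattern bridge  = inj₂ tt

Class↔Fin : ∀ q → Class q ↔ Fin (2 * q + 1)
Class↔Fin q = ↔-sym (↔-trans +↔⊎ (*↔× ⊎-cong 1↔⊤))

-- A copy of the graph with ℕ indices: constraints such as inject₁ i ≡ fromℕ p do not unify,
-- but their ℕ counterparts do, so adjacency is decided and triangles are excluded here.
data MEVertℕ : Set where
  U V₁ V₂ V₃ : ℕ → MEVertℕ

data MEEdgeℕ (p : ℕ) : MEVertℕ → MEVertℕ → Set where
  uu′    : ∀ k → MEEdgeℕ p (U k) (U (suc k))
  uv′    : MEEdgeℕ p (U (suc (suc p))) (V₁ 0)
  v12′   : ∀ i → MEEdgeℕ p (V₁ i) (V₂ i)
  v23′   : ∀ i → MEEdgeℕ p (V₂ i) (V₃ i)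
  vnext′ : ∀ i → MEEdgeℕ p (V₃ i) (V₁ (suc i))
  vu′    : MEEdgeℕ p (V₃ p) (U 0)
  spoke′ : ∀ i → MEEdgeℕ p (U (suc i)) (V₂ i)
  v13′   : ∀ i → MEEdgeℕ p (V₁ i) (V₃ i)

MEAdjℕ : ℕ → MEVertℕ → MEVertℕ → Set
MEAdjℕ p x y = MEEdgeℕ p x y ⊎ MEEdgeℕ p y x

forgetBound : ∀ {q} → MEVert q → MEVertℕ
forgetBound (u k)    = U (toℕ k)
forgetBound (v i 0F) = V₁ (toℕ i)
forgetBound (v i 1F) = V₂ (toℕ i)
forgetBound (v i 2F) = V₃ (toℕ i)

forgetBound-edge : ∀ {p x y} → MEEdge (suc p) x y → MEEdgeℕ p (forgetBound x) (forgetBound y)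
forgetBound-edge (e-uu i)    rewrite toℕ-inject₁ i = uu′ (toℕ i)
forgetBound-edge (e-uv {p})  rewrite toℕ-fromℕ p   = uv′
forgetBound-edge (e-v12 i)                         = v12′ (toℕ i)
forgetBound-edge (e-v23 i)                         = v23′ (toℕ i)
forgetBound-edge (e-vnext i) rewrite toℕ-inject₁ i = vnext′ (toℕ i)
forgetBound-edge (e-vu {p})  rewrite toℕ-fromℕ p   = vu′
forgetBound-edge (e-spoke i) rewrite toℕ-inject₁ i = spoke′ (toℕ i)
forgetBound-edge (e-v13 i)                         = v13′ (toℕ i)

forgetBound-adj : ∀ {p x y} → MEAdj (suc p) x y → MEAdjℕ p (forgetBound x) (forgetBound y)
forgetBound-adj = Sum.map forgetBound-edge forgetBound-edge

module _ {p : ℕ} where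

  edgeℕ? : Decidable (MEEdgeℕ p)
  edgeℕ? (U k)  (U j)  = map′ (λ { refl → uu′ k }) (λ { (uu′ _) → refl }) (j ≟ suc k)
  edgeℕ? (U k)  (V₁ i) = map′ (λ { (refl , refl) → uv′ }) (λ { uv′ → refl , refl }) (k ≟ suc (suc p) ×-dec i ≟ 0)
  edgeℕ? (U k)  (V₂ i) = map′ (λ { refl → spoke′ i }) (λ { (spoke′ _) → refl }) (k ≟ suc i)
  edgeℕ? (V₁ i) (V₂ j) = map′ (λ { refl → v12′ i }) (λ { (v12′ _) → refl }) (j ≟ i)
  edgeℕ? (V₁ i) (V₃ j) = map′ (λ { refl → v13′ i }) (λ { (v13′ _) → refl }) (j ≟ i)
  edgeℕ? (V₂ i) (V₃ j) = map′ (λ { refl → v23′ i }) (λ { (v23′ _) → refl }) (j ≟ i)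
  edgeℕ? (V₃ i) (V₁ j) = map′ (λ { refl → vnext′ i }) (λ { (vnext′ _) → refl }) (j ≟ suc i)
  edgeℕ? (V₃ i) (U k)  = map′ (λ { (refl , refl) → vu′ }) (λ { vu′ → refl , refl }) (i ≟ p ×-dec k ≟ 0)
  edgeℕ? (U _)  (V₃ _) = no λ ()
  edgeℕ? (V₁ _) (U _)  = no λ ()
  edgeℕ? (V₁ _) (V₁ _) = no λ ()
  edgeℕ? (V₂ _) (U _)  = no λ ()
  edgeℕ? (V₂ _) (V₁ _) = no λ ()
  edgeℕ? (V₂ _) (V₂ _) = no λ ()
  edgeℕ? (V₃ _) (V₂ _) = no λ ()
  edgeℕ? (V₃ _) (V₃ _) = no λ ()

  adjℕ? : Decidable (MEAdjℕ p)
  adjℕ? x y = edgeℕ? x y ⊎-dec edgeℕ? y x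

data MatchedPairℕ (p : ℕ) : MEVertℕ → MEVertℕ → Set where
  spokeℕ    : ∀ i → MatchedPairℕ p (U (suc i)) (V₂ i)
  bridgeℕ   : MatchedPairℕ p (U (suc (suc p))) (V₁ 0)
  linkℕ     : ∀ i → MatchedPairℕ p (V₃ i) (V₁ (suc i))
  lastLinkℕ : MatchedPairℕ p (V₃ p) (U 0)

matchedPairℕ-no-common-neighbour : ∀ {p a b z} → MatchedPairℕ p a b → MEAdjℕ p z a → ¬ MEAdjℕ p z b
matchedPairℕ-no-common-neighbour (spokeℕ _)   (inj₁ (uu′ _))    = [ (λ ()) , (λ ()) ]
matchedPairℕ-no-common-neighbour (spokeℕ _)   (inj₂ (uu′ _))    = [ (λ ()) , (λ ()) ]
matchedPairℕ-no-common-neighbour (spokeℕ _)   (inj₂ uv′)        = [ (λ ()) , (λ ()) ]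
matchedPairℕ-no-common-neighbour (spokeℕ _)   (inj₂ (spoke′ _)) = [ (λ ()) , (λ ()) ]
matchedPairℕ-no-common-neighbour bridgeℕ      (inj₁ (uu′ _))    = [ (λ ()) , (λ ()) ]
matchedPairℕ-no-common-neighbour bridgeℕ      (inj₂ (uu′ _))    = [ (λ ()) , (λ ()) ]
matchedPairℕ-no-common-neighbour bridgeℕ      (inj₂ uv′)        = [ (λ ()) , (λ ()) ]
matchedPairℕ-no-common-neighbour bridgeℕ      (inj₂ (spoke′ _)) = [ (λ ()) , (λ ()) ]
matchedPairℕ-no-common-neighbour (linkℕ _)    (inj₁ (v23′ _))   = [ (λ ()) , (λ ()) ]
matchedPairℕ-no-common-neighbour (linkℕ _)    (inj₁ (v13′ _))   = [ (λ ()) , (λ ()) ]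
matchedPairℕ-no-common-neighbour (linkℕ _)    (inj₂ (vnext′ _)) = [ (λ ()) , (λ ()) ]
matchedPairℕ-no-common-neighbour (linkℕ _)    (inj₂ vu′)        = [ (λ ()) , (λ ()) ]
matchedPairℕ-no-common-neighbour lastLinkℕ    (inj₁ (v23′ _))   = [ (λ ()) , (λ ()) ]
matchedPairℕ-no-common-neighbour lastLinkℕ    (inj₁ (v13′ _))   = [ (λ ()) , (λ ()) ]
matchedPairℕ-no-common-neighbour lastLinkℕ    (inj₂ (vnext′ _)) = [ (λ ()) , (λ ()) ]
matchedPairℕ-no-common-neighbour lastLinkℕ    (inj₂ vu′)        = [ (λ ()) , (λ ()) ]

module _ (p : ℕ) where

  uClass : {k : Fin (suc (suc p))} → View k → Class (suc p)
  uClass ‵fromℕ       = bridge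
  uClass (‵inject₁ i) = spoke i

  classOf : MEVert (suc p) → Class (suc p)
  classOf (u 0F)         = link (fromℕ p)
  classOf (u (suc k))    = uClass (view k)
  classOf (v i 1F)       = spoke i
  classOf (v i 2F)       = link i
  classOf (v 0F 0F)      = bridge
  classOf (v (suc i) 0F) = link (inject₁ i)

  linkEnd : {i : Fin (suc p)} → View i → MEVert (suc p)
  linkEnd ‵fromℕ       = u 0F
  linkEnd (‵inject₁ i) = v (suc i) 0F

  end₁ end₂ : Class (suc p) → MEVert (suc p)
  end₁ (spoke i) = u (suc (inject₁ i))
  end₁ (link i)  = v i 2F
  end₁ bridge    = u (fromℕ (suc (suc p)))
  end₂ (spoke i) = v i 1F
  end₂ (link i)  = linkEnd (view i)
  end₂ bridge    = v 0F 0F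

  classOf-end₁ : ∀ j → classOf (end₁ j) ≡ j
  classOf-end₁ (spoke i) rewrite view-inject₁ i     = refl
  classOf-end₁ (link i)                             = refl
  classOf-end₁ bridge    rewrite view-fromℕ (suc p) = refl

  classOf-end₂ : ∀ j → classOf (end₂ j) ≡ j
  classOf-end₂ (spoke i) = refl
  classOf-end₂ (link i)  = classOf-linkEnd (view i)
    where
    classOf-linkEnd : (w : View i) → classOf (linkEnd w) ≡ link i
    classOf-linkEnd ‵fromℕ       = refl
    classOf-linkEnd (‵inject₁ _) = refl
  classOf-end₂ bridge    = refl

  is-end : ∀ x → x ≡ end₁ (classOf x) ⊎ x ≡ end₂ (classOf x)
  is-end (u 0F)         rewrite view-fromℕ p   = inj₂ refl
  is-end (u (suc k))    = inj₁ (u-is-end₁ (view k))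
    where
    u-is-end₁ : (w : View k) → u (suc k) ≡ end₁ (uClass w)
    u-is-end₁ ‵fromℕ       = refl
    u-is-end₁ (‵inject₁ _) = refl
  is-end (v i 1F)       = inj₂ refl
  is-end (v i 2F)       = inj₁ refl
  is-end (v 0F 0F)      = inj₂ refl
  is-end (v (suc i) 0F) rewrite view-inject₁ i = inj₂ refl

  ends-edge : ∀ j → MEEdge (suc p) (end₁ j) (end₂ j)
  ends-edge (spoke i) = e-spoke i
  ends-edge (link i)  = link-edge (view i)
    where
    link-edge : (w : View i) → MEEdge (suc p) (v i 2F) (linkEnd w)
    link-edge ‵fromℕ       = e-vu
    link-edge (‵inject₁ j) = e-vnext j
  ends-edge bridge    = e-uv

  ends-matchedℕ : ∀ j → MatchedPairℕ p (forgetBound (end₁ j)) (forgetBound (end₂ j))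
  ends-matchedℕ (spoke i) rewrite toℕ-inject₁ i = spokeℕ (toℕ i)
  ends-matchedℕ (link i)  = link-matchedℕ (view i)
    where
    link-matchedℕ : (w : View i) → MatchedPairℕ p (V₃ (toℕ i)) (forgetBound (linkEnd w))
    link-matchedℕ ‵fromℕ       rewrite toℕ-fromℕ p   = lastLinkℕ
    link-matchedℕ (‵inject₁ j) rewrite toℕ-inject₁ j = linkℕ (toℕ j)
  ends-matchedℕ bridge    rewrite toℕ-fromℕ p = bridgeℕ

  matching : TriangleFreeMatching (MEAdj (suc p)) classOf
  matching = record
    { end₁                = end₁
    ; end₂                = end₂
    ; class-end₁          = classOf-end₁
    ; class-end₂          = classOf-end₂
    ; is-end              = is-end
    ; ends-adjacent       = inj₁ ∘ ends-edge
    ; no-common-neighbour = λ j → pullback-no-common-neighbour forgetBound forgetBound-adj adjℕ?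
                                    (matchedPairℕ-no-common-neighbour (ends-matchedℕ j))
    }

theorem5 : (q : ℕ) → 2 ≤ q →
    Σ (MEVert q → Fin (2 * q + 1)) (λ c →
      IsCliquePartition (MEAdj q) (2 * q + 1) c × IsFrozen (MEAdj q) (2 * q + 1) c)
-- q ≥ 1 suffices.
theorem5 (suc p) _ = _ , isCliquePartition M swap , isFrozen M
  where
  M : TriangleFreeMatching (MEAdj (suc p)) (Inverse.to (Class↔Fin (suc p)) ∘ classOf p)
  M = reindex (Class↔Fin (suc p)) (matching p)
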